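{- Let $n\geq 2$ and let $H_n = G_2\cup G_3\cup\cdots\cup G_n$, where each $G_k$ is the weighted directed graph defined below for $\ell=2$, and the union identifies nodes with the same integer label (node set and edge set are the unions). Then the maximum weight of a directed path from node $0$ to node $2^n-1$ in $H_n$ is $0$.
   Context: The pruning function $\operatorname{P}_{2}:\mathbb{Z}_{>0}\to\mathbb{Z}_{\geq 0}$: write $m$ in binary, padded on the left with zeros as needed, let $z$ be the position (position $0$ = least significant bit) of the second zero bit counted from the right, let $q = 2^{z}\lfloor m/2^{z}\rfloor$, and set $\operatorname{P}_2(m)=\max(q-1,0)$. For an integer $k\ge 2$, $G_k$ is the weighted directed graph with node set $\{0\}\cup\{2^{k-1}-1,2^{k-1},\ldots,2^k-1\}$ and edges: for each $m$ with $2^{k-1}-1\le m<2^k-1$, a "blue" edge from $m$ to $m+1$ of weight $-1$ and a "red" edge from $\operatorname{P}_2(m)$ to $m$ of weight $+1$. The weight of a path is the sum of the weights of its edges. -}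

module Defs where

open import Data.Nat using (ℕ; zero; suc; _+_; _*_; _∸_; _^_; _≤_; _<_; _⊔_)
open import Data.Nat.DivMod using (_/_; _%_)
open import Data.Integer as ℤ using (ℤ; +_; -[1+_])

-- position of the second zero bit of m (position 0 = least significant bit).
-- secondZeroGo fuel k m : position (relative to the current bit) of the k-th
-- zero bit (k ≥ 1) of m, scanning from the least significant bit.
-- The fuel (m + 2) always suffices: after at most ⌊log₂ m⌋ + 1 halvings m
-- becomes 0, whose bits are all zero, so two more steps finish the scan.
secondZeroGo : ℕ → ℕ → ℕ → ℕ
secondZeroGo zero          k             m = 0
secondZeroGo (suc f)       zero          m = 0
secondZeroGo (suc f)       (suc k)       m with m % 2
... | zero  with k
...   | zero  = 0
...   | suc j = suc (secondZeroGo f (suc j) (m / 2))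
secondZeroGo (suc f) (suc k) m | suc _ = suc (secondZeroGo f (suc k) (m / 2))

secondZero : ℕ → ℕ
secondZero m = secondZeroGo (m + 2) 2 m

P₂ : ℕ → ℕ
P₂ m = (2 ^ z * ((m / 2 ^ z) {{nz z}})) ∸ 1
  where
  z = secondZero m
  nz : (i : ℕ) → Data.Nat.NonZero (2 ^ i)
  nz i = Data.Nat.Properties.m^n≢0 2 i
    where import Data.Nat.Properties
  -- (natural subtraction ∸ 1 is exactly max(q - 1, 0))

data Edge (n : ℕ) : ℕ → ℕ → ℤ → Set where
  blue : (k m : ℕ) → 2 ≤ k → k ≤ n →
         2 ^ (k ∸ 1) ∸ 1 ≤ m → m < 2 ^ k ∸ 1 →
         Edge n m (suc m) (ℤ.- (+ 1))
  red  : (k m : ℕ) → 2 ≤ k → k ≤ n →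
         2 ^ (k ∸ 1) ∸ 1 ≤ m → m < 2 ^ k ∸ 1 →
         Edge n (P₂ m) m (+ 1)

-- directed paths in H n from a to b (every edge goes to a strictly larger
-- node, so walks and paths coincide)
data Path (n : ℕ) : ℕ → ℕ → Set where
  []  : ∀ {a} → Path n a a
  _∷_ : ∀ {a b c w} → Edge n a b w → Path n b c → Path n a c

weight : ∀ {n a b} → Path n a b → ℤ
weight [] = + 0
weight (_∷_ {w = w} e p) = w ℤ.+ weight p

-- Give every node v ≥ 1 the potential max(1, number of zero bits of v), node 0
-- the potential 0, and lower the potential of the sink 2ⁿ - 1 from 1 to 0 (its
-- only in-edges start at 2ⁿ - 2, which has a single zero bit).
-- Incrementing m destroys at most one zero bit, so a blue edge (weight -1)
-- lowers the potential by at most 1.  If z is the second zero of m, then P₂ m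
-- agrees with m above the lowest set bit t > z of 2^z ⌊m/2^z⌋ and is all ones
-- below t; it has lost the two zeros of m at or below z and gained at most one,
-- so a red edge (weight +1) raises the potential by at least 1.  Hence every
-- path from 0 to 2ⁿ - 1 has weight at most 0, and 0 → 2ⁿ - 2 → 2ⁿ - 1 attains it.
module Submission where

open import Data.Bool using (Bool; true; false)
open import Data.List using (List; []; _∷_)
open import Data.Nat
  using (ℕ; zero; suc; _+_; _*_; _∸_; _^_; _⊔_; _≤_; _<_; z≤n; s≤s; _≟_)
open import Data.Nat.Properties
open import Data.Nat.DivMod
open import Data.Nat.Divisibility using (m∣m*n)
import Data.Integer
open import Data.Integer as ℤ using (ℤ; +_; -[1+_]; +≤+)
import Data.Integer.Properties as ℤ
open import Data.Product using (Σ; _×_; _,_)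
open import Function using (_∘_)
open import Relation.Nullary using (yes; no; contradiction)
open import Relation.Binary.PropositionalEquality
open import Defs

double-suc : ∀ h → 2 * suc h ≡ suc (suc (2 * h))
double-suc h = cong suc (+-suc h (h + 0))

data ParityView : ℕ → Set where
  even : ∀ h → ParityView (2 * h)
  odd  : ∀ h → ParityView (suc (2 * h))

parityView : ∀ m → ParityView m
parityView zero = even 0
parityView (suc m) with parityView m
... | even h = odd h
... | odd h  = subst ParityView (double-suc h) (even (suc h))

-- Binary digits, least significant first and without leading zeros.
inc : List Bool → List Bool
inc []           = true ∷ []
inc (false ∷ bs) = true ∷ bs
inc (true ∷ bs)  = false ∷ inc bs

bits : ℕ → List Bool
bits zero    = []
bits (suc m) = inc (bits m)

zeroCount : List Bool → ℕ
zeroCount []           = 0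
zeroCount (false ∷ bs) = suc (zeroCount bs)
zeroCount (true ∷ bs)  = zeroCount bs

zeros : ℕ → ℕ
zeros m = zeroCount (bits m)

bits-double : ∀ h → bits (2 * suc h) ≡ false ∷ bits (suc h)
bits-double zero    = refl
bits-double (suc h) = begin
  bits (2 * suc (suc h))       ≡⟨ cong bits (*-suc 2 (suc h)) ⟩
  inc (inc (bits (2 * suc h))) ≡⟨ cong (inc ∘ inc) (bits-double h) ⟩
  false ∷ inc (bits (suc h))   ∎
  where open ≡-Reasoning

bits-odd : ∀ h → bits (suc (2 * h)) ≡ true ∷ bits h
bits-odd zero    = refl
bits-odd (suc h) = cong inc (bits-double h)

zeros-double : ∀ h → zeros (2 * suc h) ≡ suc (zeros (suc h))
zeros-double h = cong zeroCount (bits-double h)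

zeros-odd : ∀ h → zeros (suc (2 * h)) ≡ zeros h
zeros-odd h = cong zeroCount (bits-odd h)

zeros-double∸1 : ∀ q → zeros (2 * q ∸ 1) ≡ zeros (q ∸ 1)
zeros-double∸1 zero    = refl
zeros-double∸1 (suc r) = trans (cong (λ m → zeros (m ∸ 1)) (double-suc r)) (zeros-odd r)

zeroCount-inc : ∀ bs → zeroCount bs ≤ suc (zeroCount (inc bs))
zeroCount-inc []           = z≤n
zeroCount-inc (false ∷ bs) = ≤-refl
zeroCount-inc (true ∷ bs)  = m≤n⇒m≤1+n (zeroCount-inc bs)

zeros≤suc-zeros-suc : ∀ m → zeros m ≤ suc (zeros (suc m))
zeros≤suc-zeros-suc m = zeroCount-inc (bits m)

allOnes-suc : ∀ j → 2 ^ suc j ∸ 1 ≡ suc (2 * (2 ^ j ∸ 1))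
allOnes-suc j with 2 ^ j | m^n>0 2 j
... | suc y | _ = cong (_∸ 1) (double-suc y)

zeros-allOnes : ∀ j → zeros (2 ^ j ∸ 1) ≡ 0
zeros-allOnes zero    = refl
zeros-allOnes (suc j) = trans (cong zeros (allOnes-suc j)) (trans (zeros-odd (2 ^ j ∸ 1)) (zeros-allOnes j))

double%2 : ∀ h → 2 * h % 2 ≡ 0
double%2 h = %-remove-+ʳ 0 {d = 2} (m∣m*n {2} h)

double/2 : ∀ h → 2 * h / 2 ≡ h
double/2 h = trans (cong (_/ 2) (*-comm 2 h)) (m*n/n≡m h 2)

odd%2 : ∀ h → suc (2 * h) % 2 ≡ 1
odd%2 h = %-remove-+ʳ 1 {d = 2} (m∣m*n {2} h)

odd/2 : ∀ h → suc (2 * h) / 2 ≡ h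
odd/2 h = trans (+-distrib-/-∣ʳ 1 {d = 2} (m∣m*n {2} h)) (double/2 h)

secondZeroGo-odd : ∀ f k h →
  secondZeroGo (suc f) (suc k) (suc (2 * h)) ≡ suc (secondZeroGo f (suc k) h)
secondZeroGo-odd f k h rewrite odd%2 h | odd/2 h = refl

secondZeroGo-even-first : ∀ f h → secondZeroGo (suc f) 1 (2 * h) ≡ 0
secondZeroGo-even-first f h rewrite double%2 h = refl

secondZeroGo-even : ∀ f k h →
  secondZeroGo (suc f) (suc (suc k)) (2 * h) ≡ suc (secondZeroGo f (suc k) h)
secondZeroGo-even f k h rewrite double%2 h | double/2 h = refl

roundDown : ℕ → ℕ → ℕ
roundDown z m = 2 ^ z * (m / 2 ^ z) {{m^n≢0 2 z}}

roundDown-zeroˡ : ∀ m → roundDown 0 m ≡ m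
roundDown-zeroˡ m = trans (+-identityʳ _) (n/1≡n m)

roundDown-zeroʳ : ∀ z → roundDown z 0 ≡ 0
roundDown-zeroʳ z = trans (cong (2 ^ z *_) (0/n≡0 (2 ^ z) {{m^n≢0 2 z}})) (*-zeroʳ (2 ^ z))

roundDown-suc : ∀ z m → roundDown (suc z) m ≡ 2 * roundDown z (m / 2)
roundDown-suc z m = begin
  2 * 2 ^ z * (m / (2 * 2 ^ z)) {{m^n≢0 2 (suc z)}}
    ≡⟨ cong (2 * 2 ^ z *_) (m/n/o≡m/[n*o] m 2 (2 ^ z) {{_}} {{m^n≢0 2 z}} {{m^n≢0 2 (suc z)}}) ⟨
  2 * 2 ^ z * (m / 2 / 2 ^ z) {{m^n≢0 2 z}}
    ≡⟨ *-assoc 2 (2 ^ z) _ ⟩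
  2 * roundDown z (m / 2)       ∎
  where open ≡-Reasoning

roundAtZero : ℕ → ℕ → ℕ → ℕ
roundAtZero f k m = roundDown (secondZeroGo f k m) m

roundAtZero-odd : ∀ f k h →
  roundAtZero (suc f) (suc k) (suc (2 * h)) ≡ 2 * roundAtZero f (suc k) h
roundAtZero-odd f k h = begin
  roundDown (secondZeroGo (suc f) (suc k) (suc (2 * h))) (suc (2 * h))
    ≡⟨ cong (λ z → roundDown z (suc (2 * h))) (secondZeroGo-odd f k h) ⟩
  roundDown (suc (secondZeroGo f (suc k) h)) (suc (2 * h))
    ≡⟨ roundDown-suc (secondZeroGo f (suc k) h) (suc (2 * h)) ⟩
  2 * roundDown (secondZeroGo f (suc k) h) (suc (2 * h) / 2)
    ≡⟨ cong (λ m → 2 * roundDown (secondZeroGo f (suc k) h) m) (odd/2 h) ⟩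
  2 * roundAtZero f (suc k) h ∎
  where open ≡-Reasoning

roundAtZero-even : ∀ f k h →
  roundAtZero (suc f) (suc (suc k)) (2 * h) ≡ 2 * roundAtZero f (suc k) h
roundAtZero-even f k h = begin
  roundDown (secondZeroGo (suc f) (suc (suc k)) (2 * h)) (2 * h)
    ≡⟨ cong (λ z → roundDown z (2 * h)) (secondZeroGo-even f k h) ⟩
  roundDown (suc (secondZeroGo f (suc k) h)) (2 * h)
    ≡⟨ roundDown-suc (secondZeroGo f (suc k) h) (2 * h) ⟩
  2 * roundDown (secondZeroGo f (suc k) h) (2 * h / 2)
    ≡⟨ cong (λ m → 2 * roundDown (secondZeroGo f (suc k) h) m) (double/2 h) ⟩
  2 * roundAtZero f (suc k) h ∎
  where open ≡-Reasoning

roundAtZero-even-first : ∀ f h → roundAtZero (suc f) 1 (2 * h) ≡ 2 * h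
roundAtZero-even-first f h =
  trans (cong (λ z → roundDown z (2 * h)) (secondZeroGo-even-first f h)) (roundDown-zeroˡ (2 * h))

zeros-roundAtZero : ∀ f k m → m < f → 1 ≤ roundAtZero f (suc k) m →
  k + (1 ⊔ zeros (roundAtZero f (suc k) m ∸ 1)) ≤ zeros m
zeros-roundAtZero (suc f) k m (s≤s m≤f) q>0 with parityView m
... | even zero =
  contradiction (subst (1 ≤_) (roundDown-zeroʳ (secondZeroGo (suc f) (suc k) 0)) q>0) λ ()
... | odd h
  rewrite roundAtZero-odd f k h
        | zeros-double∸1 (roundAtZero f (suc k) h)
        | zeros-odd h
  = zeros-roundAtZero f k h (≤-trans (s≤s (m≤m+n h (h + 0))) m≤f) (*-cancelˡ-< 2 0 _ q>0)
... | even (suc h) with k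
...   | zero
  rewrite roundAtZero-even-first f (suc h)
        | zeros-double∸1 (suc h)
        | zeros-double h
  = ⊔-lub (s≤s z≤n) (zeros≤suc-zeros-suc h)
...   | suc j
  rewrite roundAtZero-even f j (suc h)
        | zeros-double∸1 (roundAtZero f (suc j) (suc h))
        | zeros-double h
  = s≤s (zeros-roundAtZero f j (suc h) (≤-trans (s≤s (m<m+n h (s≤s z≤n))) m≤f) (*-cancelˡ-< 2 0 _ q>0))

zeros-P₂ : ∀ m → 1 ≤ P₂ m → suc (1 ⊔ zeros (P₂ m)) ≤ zeros m
zeros-P₂ m P₂>0 = zeros-roundAtZero (m + 2) 1 m (m<m+n m (s≤s z≤n))
  (≤-trans P₂>0 (m∸n≤m (roundAtZero (m + 2) 2 m) 1))

P₂≡0 : ∀ m → zeros m ≤ 1 → P₂ m ≡ 0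
P₂≡0 m zeros≤1 with P₂ m | zeros-P₂ m
... | zero  | _ = refl
... | suc r | bound = contradiction two≤1 λ { (s≤s ()) }
  where
  two≤1 : 2 ≤ 1
  two≤1 = ≤-trans (s≤s (m≤m⊔n 1 (zeros (suc r)))) (≤-trans (bound (s≤s z≤n)) zeros≤1)

zeros-double-allOnes : ∀ j → zeros (2 * (2 ^ j ∸ 1)) ≤ 1
zeros-double-allOnes zero    = z≤n
zeros-double-allOnes (suc j) = ≤-reflexive (begin
  zeros (2 * (2 ^ suc j ∸ 1))         ≡⟨ cong (λ m → zeros (2 * m)) (allOnes-suc j) ⟩
  zeros (2 * suc (2 * (2 ^ j ∸ 1)))   ≡⟨ zeros-double (2 * (2 ^ j ∸ 1)) ⟩
  suc (zeros (suc (2 * (2 ^ j ∸ 1)))) ≡⟨ cong suc (zeros-odd (2 ^ j ∸ 1)) ⟩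
  suc (zeros (2 ^ j ∸ 1))             ≡⟨ cong suc (zeros-allOnes j) ⟩
  1                                   ∎)
  where open ≡-Reasoning

zeros≤1-below-allOnes : ∀ n m → suc m ≡ 2 ^ n ∸ 1 → zeros m ≤ 1
zeros≤1-below-allOnes zero    m ()
zeros≤1-below-allOnes (suc j) m eq =
  subst (λ x → zeros x ≤ 1) (sym (suc-injective (trans eq (allOnes-suc j)))) (zeros-double-allOnes j)

potential : ℕ → ℕ
potential zero       = 0
potential m@(suc _) = 1 ⊔ zeros m

potential≤ : ∀ m → potential m ≤ 1 ⊔ zeros m
potential≤ zero    = z≤n
potential≤ (suc m) = ≤-refl

potential≤suc-potential-suc : ∀ m → potential m ≤ suc (potential (suc m))
potential≤suc-potential-suc zero    = z≤n
potential≤suc-potential-suc (suc m) =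
  ⊔-lub (s≤s z≤n) (≤-trans (zeros≤suc-zeros-suc (suc m)) (s≤s (m≤n⊔m 1 _)))

potential-P₂< : ∀ m → 1 ≤ m → potential (P₂ m) < potential m
potential-P₂< m@(suc _) _ with P₂ m | zeros-P₂ m
... | zero  | _     = m≤m⊔n 1 (zeros m)
... | suc _ | bound = ≤-trans (bound (s≤s z≤n)) (m≤n⊔m 1 (zeros m))

potentialIn : ℕ → ℕ → ℕ
potentialIn n v with v ≟ 2 ^ n ∸ 1
... | yes _ = 0
... | no _  = potential v

potentialIn-sink : ∀ n → potentialIn n (2 ^ n ∸ 1) ≡ 0
potentialIn-sink n with (2 ^ n ∸ 1) ≟ 2 ^ n ∸ 1
... | yes _ = refl
... | no ≢  = contradiction refl ≢

potentialIn-zero : ∀ n → potentialIn n 0 ≡ 0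
potentialIn-zero n with 0 ≟ 2 ^ n ∸ 1
... | yes _ = refl
... | no _  = refl

potentialIn≤potential : ∀ n v → potentialIn n v ≤ potential v
potentialIn≤potential n v with v ≟ 2 ^ n ∸ 1
... | yes _ = z≤n
... | no _  = ≤-refl

potentialIn-below-sink : ∀ n v → v < 2 ^ n ∸ 1 → potentialIn n v ≡ potential v
potentialIn-below-sink n v v<sink with v ≟ 2 ^ n ∸ 1
... | yes v≡sink = contradiction v≡sink (<⇒≢ v<sink)
... | no _       = refl

potential≤suc-potentialIn-suc : ∀ n m → potential m ≤ suc (potentialIn n (suc m))
potential≤suc-potentialIn-suc n m with suc m ≟ 2 ^ n ∸ 1
... | yes sink = ≤-trans (potential≤ m) (⊔-lub ≤-refl (zeros≤1-below-allOnes n m sink))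
... | no _     = potential≤suc-potential-suc m

2^[k∸1]∸1≤m⇒0<m : ∀ k m → 2 ≤ k → 2 ^ (k ∸ 1) ∸ 1 ≤ m → 0 < m
2^[k∸1]∸1≤m⇒0<m (suc zero)    m (s≤s ())
2^[k∸1]∸1≤m⇒0<m (suc (suc j)) m _ lo = ≤-trans (s≤s z≤n) (subst (_≤ m) (allOnes-suc j) lo)

edge-potentialIn : ∀ {n a b w} → Edge n a b w → w ℤ.+ + potentialIn n a ℤ.≤ + potentialIn n b
edge-potentialIn {n} (blue k m _ _ _ _) =
  ℤ.+-monoʳ-≤ -[1+ 0 ] {+ potentialIn n m} {+ suc (potentialIn n (suc m))}
    (+≤+ (≤-trans (potentialIn≤potential n m) (potential≤suc-potentialIn-suc n m)))
edge-potentialIn {n} (red k m 2≤k k≤n lo hi) = +≤+ (begin-strict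
  potentialIn n (P₂ m) ≤⟨ potentialIn≤potential n (P₂ m) ⟩
  potential (P₂ m)     <⟨ potential-P₂< m (2^[k∸1]∸1≤m⇒0<m k m 2≤k lo) ⟩
  potential m          ≡⟨ potentialIn-below-sink n m m<sink ⟨
  potentialIn n m      ∎)
  where
  open ≤-Reasoning
  m<sink : m < 2 ^ n ∸ 1
  m<sink = ≤-trans hi (∸-monoˡ-≤ 1 (^-monoʳ-≤ 2 k≤n))

weight+potential≤potential : ∀ {n a b} (φ : ℕ → ℤ) →
  (∀ {u v w} → Edge n u v w → w ℤ.+ φ u ℤ.≤ φ v) →
  (p : Path n a b) → weight p ℤ.+ φ a ℤ.≤ φ b
weight+potential≤potential φ edge-ok [] = ℤ.≤-reflexive (ℤ.+-identityˡ _)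
weight+potential≤potential {a = a} φ edge-ok (_∷_ {b = b} {c = c} {w = w} e p) = begin
  (w ℤ.+ weight p) ℤ.+ φ a ≡⟨ cong (ℤ._+ φ a) (ℤ.+-comm w (weight p)) ⟩
  (weight p ℤ.+ w) ℤ.+ φ a ≡⟨ ℤ.+-assoc (weight p) w (φ a) ⟩
  weight p ℤ.+ (w ℤ.+ φ a) ≤⟨ ℤ.+-monoʳ-≤ (weight p) (edge-ok e) ⟩
  weight p ℤ.+ φ b         ≤⟨ weight+potential≤potential φ edge-ok p ⟩
  φ c                      ∎
  where open ℤ.≤-Reasoning

weight-zero-path : ∀ n → 2 ≤ n → Σ (Path n 0 (2 ^ n ∸ 1)) (λ p → weight p ≡ + 0)
weight-zero-path (suc j) 2≤n rewrite allOnes-suc j = red-edge ∷ blue-edge ∷ [] , refl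
  where
  penultimate : ℕ
  penultimate = 2 * (2 ^ j ∸ 1)
  lo : 2 ^ j ∸ 1 ≤ penultimate
  lo = m≤m+n (2 ^ j ∸ 1) _
  hi : penultimate < 2 ^ suc j ∸ 1
  hi = ≤-reflexive (sym (allOnes-suc j))
  red-edge : Edge (suc j) 0 penultimate (+ 1)
  red-edge = subst (λ a → Edge (suc j) a penultimate (+ 1)) (P₂≡0 penultimate (zeros-double-allOnes j))
    (red (suc j) penultimate 2≤n ≤-refl lo hi)
  blue-edge : Edge (suc j) penultimate (suc penultimate) (ℤ.- (+ 1))
  blue-edge = blue (suc j) penultimate 2≤n ≤-refl lo hi

mainTheorem11 : (n : ℕ) → 2 ≤ n →
    (Σ (Path n 0 (2 ^ n ∸ 1)) (λ p → weight p ≡ + 0)) ×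
    ((p : Path n 0 (2 ^ n ∸ 1)) → weight p Data.Integer.≤ + 0)
mainTheorem11 n 2≤n = weight-zero-path n 2≤n , weight≤0
  where
  open ℤ.≤-Reasoning
  weight≤0 : (p : Path n 0 (2 ^ n ∸ 1)) → weight p ℤ.≤ + 0
  weight≤0 p = begin
    weight p                            ≡⟨ ℤ.+-identityʳ (weight p) ⟨
    weight p ℤ.+ + 0                    ≡⟨ cong (λ x → weight p ℤ.+ + x) (potentialIn-zero n) ⟨
    weight p ℤ.+ + potentialIn n 0      ≤⟨ weight+potential≤potential (+_ ∘ potentialIn n) edge-potentialIn p ⟩
    + potentialIn n (2 ^ n ∸ 1)         ≡⟨ cong +_ (potentialIn-sink n) ⟩
    + 0                                 ∎
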